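{- Let $G$ be a group definable in a structure $M$. Then $G$ has a definable paradoxical decomposition if and only if $(n+1)G\le nG$ for some $n\ge1$.
   Context: "Definable" means definable with parameters from $M$. A cycle is a formal sum $\sum_{i=1}^m X_i$ of definable subsets $X_i$ of $G$; $mG$ denotes the sum of $m$ copies of $G$, and cycles are added formally. A definable piecewise translation from $X=\sum_{i=1}^m X_i$ to $Y=\sum_{j=1}^n Y_j$ is a map $f$ from the formal disjoint union $X_1\sqcup\dots\sqcup X_m$ to $Y_1\sqcup\dots\sqcup Y_n$ such that each $X_i$ is partitioned into finitely many definable sets $X_{it}$ and for each $i,t$ there is $g_{it}\in G$ with $f|_{X_{it}}$ equal to left translation by $g_{it}$ and $g_{it}X_{it}$ contained in a single $Y_j$. It is injective if it is injective as a map between the formal disjoint unions. $X\le Y$ means there is an injective definable piecewise translation from $X$ to $Y$. A definable paradoxical decomposition of $G$ is an injective definable piecewise translation from $G+Y$ to $Y$ for some cycle $Y$. -}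

module Defs where

open import Level using (0ℓ)
open import Data.Nat using (ℕ; suc)
open import Data.Fin using (Fin)
open import Data.List using (List; length; lookup; replicate; _∷_; [])
open import Data.Product using (Σ; ∃; ∃-syntax; _×_; _,_)
open import Data.Sum using (_⊎_)
open import Data.Empty using (⊥)
open import Data.Unit using (⊤)
open import Relation.Nullary using (¬_)
open import Relation.Binary.PropositionalEquality using (_≡_)

Subset : Set → Set₁
Subset A = A → Set

-- A group G definable in a structure M, together with the family of its
-- M-definable (with parameters) subsets.
record DefinableGroup : Set₂ where
  field
    Carrier : Set
    _∙_     : Carrier → Carrier → Carrier
    ε       : Carrier
    _⁻¹     : Carrier → Carrier
    assoc   : ∀ x y z → (x ∙ y) ∙ z ≡ x ∙ (y ∙ z)
    identityˡ : ∀ x → ε ∙ x ≡ x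
    identityʳ : ∀ x → x ∙ ε ≡ x
    inverseˡ  : ∀ x → (x ⁻¹) ∙ x ≡ ε
    inverseʳ  : ∀ x → x ∙ (x ⁻¹) ≡ ε
    Definable : Subset Carrier → Set₁
    def-ext   : ∀ {X Y : Subset Carrier} → (∀ x → (X x → Y x) × (Y x → X x)) →
                Definable X → Definable Y
    def-univ  : Definable (λ _ → ⊤)
    def-empty : Definable (λ _ → ⊥)
    def-∩     : ∀ {X Y} → Definable X → Definable Y → Definable (λ x → X x × Y x)
    def-∪     : ∀ {X Y} → Definable X → Definable Y → Definable (λ x → X x ⊎ Y x)
    def-∁     : ∀ {X} → Definable X → Definable (λ x → ¬ X x)
    def-trans : ∀ {X} (g : Carrier) → Definable X →
                Definable (λ y → Σ Carrier λ x → X x × (g ∙ x ≡ y))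

module _ (D : DefinableGroup) where
  open DefinableGroup D

  record DefSet : Set₁ where
    constructor defset
    field
      set : Subset Carrier
      def : Definable set
  open DefSet public

  Gset : DefSet
  Gset = defset (λ _ → ⊤) def-univ

  -- cycles: formal sums X₁ + … + Xₘ of definable subsets; formal addition is _++_
  Cycle : Set₁
  Cycle = List DefSet

  _·G : ℕ → Cycle
  m ·G = replicate m Gset

  comp : (X : Cycle) → Fin (length X) → Subset Carrier
  comp X i = set (lookup X i)

  record Piece (X Y : Cycle) : Set₁ where
    field
      src   : Fin (length X)
      dom   : DefSet
      dom⊆  : ∀ x → set dom x → comp X src x
      elt   : Carrier
      tgt   : Fin (length Y)
      into  : ∀ x → set dom x → comp Y tgt (elt ∙ x)

  -- a definable piecewise translation from X to Y: finitely many pieces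
  -- which partition each component X_i.  The map sends (i , x), x ∈ X_{it},
  -- to (j_{it} , g_{it} x).
  record PiecewiseTranslation (X Y : Cycle) : Set₁ where
    field
      npieces  : ℕ
      piece    : Fin npieces → Piece X Y
      cover    : ∀ i x → comp X i x →
                 ∃[ k ] (Piece.src (piece k) ≡ i × set (Piece.dom (piece k)) x)
      disjoint : ∀ k k' x → Piece.src (piece k) ≡ Piece.src (piece k') →
                 set (Piece.dom (piece k)) x → set (Piece.dom (piece k')) x → k ≡ k'

  -- injectivity as a map between the formal disjoint unions
  Injective : ∀ {X Y} → PiecewiseTranslation X Y → Set
  Injective {X} {Y} f = ∀ k k' x x' →
      set (Piece.dom (piece k)) x → set (Piece.dom (piece k')) x' →
      Piece.tgt (piece k) ≡ Piece.tgt (piece k') →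
      Piece.elt (piece k) ∙ x ≡ Piece.elt (piece k') ∙ x' →
      Piece.src (piece k) ≡ Piece.src (piece k') × x ≡ x'
    where open PiecewiseTranslation f

  _≼_ : Cycle → Cycle → Set₁
  X ≼ Y = Σ (PiecewiseTranslation X Y) Injective

  HasDefParadoxicalDecomposition : Set₁
  HasDefParadoxicalDecomposition = Σ Cycle λ Y → Σ (PiecewiseTranslation (Gset ∷ Y) Y) Injective

-- If G + Y ≤ Y, composing the decomposition with itself k times gives
-- (k+1)G + Y ≤ Y; with m = |Y| ≥ 1 (Y cannot be empty, as ε ∈ G must land
-- somewhere) this yields (m+1)G ≤ (m+1)G + Y ≤ Y ≤ mG.  Conversely, if
-- (n+1)G ≤ nG then nG itself witnesses G + nG ≤ nG.
module Submission where

open import Defs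
open import Data.Nat using (ℕ; suc; zero; _≤_; s≤s; z≤n; _*_)
open import Data.Product using (Σ; _×_; _,_; proj₁; proj₂; uncurry)
open import Function.Bundles using (_⇔_; mk⇔)
open import Data.Fin using (Fin; combine; remQuot; _≟_) renaming (zero to fzero; suc to fsuc)
open import Data.Fin.Properties using (suc-injective; remQuot-combine; combine-remQuot)
open import Data.List using (_∷_; []; _++_; replicate; length)
open import Data.Empty using (⊥-elim)
open import Data.Unit using (tt)
open import Relation.Nullary using (¬_; yes; no)
open import Relation.Binary.PropositionalEquality

module _ (D : DefinableGroup) where
  open DefinableGroup D

  G : DefSet D
  G = Gset D

  infix 4 _≲_
  _≲_ : Cycle D → Cycle D → Set₁
  _≲_ = _≼_ D

  ⁻¹∙-cancel : ∀ a y → (a ⁻¹) ∙ (a ∙ y) ≡ y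
  ⁻¹∙-cancel a y = begin
    (a ⁻¹) ∙ (a ∙ y)  ≡⟨ sym (assoc _ _ _) ⟩
    ((a ⁻¹) ∙ a) ∙ y  ≡⟨ cong (_∙ y) (inverseˡ a) ⟩
    ε ∙ y             ≡⟨ identityˡ y ⟩
    y                 ∎
    where open ≡-Reasoning

  ∙⁻¹-cancel : ∀ a y → a ∙ ((a ⁻¹) ∙ y) ≡ y
  ∙⁻¹-cancel a y = begin
    a ∙ ((a ⁻¹) ∙ y)  ≡⟨ sym (assoc _ _ _) ⟩
    (a ∙ (a ⁻¹)) ∙ y  ≡⟨ cong (_∙ y) (inverseʳ a) ⟩
    ε ∙ y             ≡⟨ identityˡ y ⟩
    y                 ∎
    where open ≡-Reasoning

  ∙-cancelˡ : ∀ a {x y} → a ∙ x ≡ a ∙ y → x ≡ y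
  ∙-cancelˡ a {x} {y} e = begin
    x                 ≡⟨ sym (⁻¹∙-cancel a x) ⟩
    (a ⁻¹) ∙ (a ∙ x)  ≡⟨ cong ((a ⁻¹) ∙_) e ⟩
    (a ⁻¹) ∙ (a ∙ y)  ≡⟨ ⁻¹∙-cancel a y ⟩
    y                 ∎
    where open ≡-Reasoning

  -- The preimage of Q under x ↦ a x is the translate a⁻¹ Q.
  preimage-definable : (a : Carrier) (Q : DefSet D) → Definable (λ x → set Q (a ∙ x))
  preimage-definable a Q = def-ext translate⇔preimage (def-trans (a ⁻¹) (def Q))
    where
    translate⇔preimage : ∀ y →
      ((Σ Carrier λ x → set Q x × ((a ⁻¹) ∙ x ≡ y)) → set Q (a ∙ y)) ×
      (set Q (a ∙ y) → Σ Carrier λ x → set Q x × ((a ⁻¹) ∙ x ≡ y))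
    translate⇔preimage y =
        (λ { (x , q , e) → subst (set Q) (trans (sym (∙⁻¹-cancel a x)) (cong (a ∙_) e)) q })
      , (λ q → a ∙ y , q , ⁻¹∙-cancel a y)

  []≲Z : ∀ Z → [] ≲ Z
  []≲Z Z = record { npieces = 0 ; piece = λ () ; cover = λ () ; disjoint = λ () } , λ ()

  module Cons {A B : DefSet D} {X Y : Cycle D}
              (A⊆B : ∀ x → set A x → set B x) (f : PiecewiseTranslation D X Y) where
    open PiecewiseTranslation f

    identity-piece : Piece D (A ∷ X) (B ∷ Y)
    identity-piece = record
      { src = fzero ; dom = A ; dom⊆ = λ x a → a ; elt = ε ; tgt = fzero
      ; into = λ x a → subst (set B) (sym (identityˡ x)) (A⊆B x a) }

    shift : Piece D X Y → Piece D (A ∷ X) (B ∷ Y)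
    shift P = record
      { src = fsuc (Piece.src P) ; dom = Piece.dom P ; dom⊆ = Piece.dom⊆ P
      ; elt = Piece.elt P ; tgt = fsuc (Piece.tgt P) ; into = Piece.into P }

    pieces : Fin (suc npieces) → Piece D (A ∷ X) (B ∷ Y)
    pieces fzero    = identity-piece
    pieces (fsuc k) = shift (piece k)

    pieces-cover : ∀ i x → comp D (A ∷ X) i x →
      Σ (Fin (suc npieces)) λ k → (Piece.src (pieces k) ≡ i) × set (Piece.dom (pieces k)) x
    pieces-cover fzero    x a = fzero , refl , a
    pieces-cover (fsuc i) x a with cover i x a
    ... | k , src≡i , x∈k = fsuc k , cong fsuc src≡i , x∈k

    pieces-disjoint : ∀ k k' x → Piece.src (pieces k) ≡ Piece.src (pieces k') →
      set (Piece.dom (pieces k)) x → set (Piece.dom (pieces k')) x → k ≡ k'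
    pieces-disjoint fzero    fzero     x e d d' = refl
    pieces-disjoint (fsuc k) (fsuc k') x e d d' = cong fsuc (disjoint k k' x (suc-injective e) d d')

    translation : PiecewiseTranslation D (A ∷ X) (B ∷ Y)
    translation = record
      { npieces = suc npieces ; piece = pieces ; cover = pieces-cover ; disjoint = pieces-disjoint }

    translation-injective : Injective D f → Injective D translation
    translation-injective inj fzero    fzero     x x' d d' et e = refl , ∙-cancelˡ ε e
    translation-injective inj (fsuc k) (fsuc k') x x' d d' et e
      with inj k k' x x' d d' (suc-injective et) e
    ... | src≡ , x≡x' = cong fsuc src≡ , x≡x'

  ∷-mono-≲ : ∀ {A B X Y} → (∀ x → set A x → set B x) → X ≲ Y → A ∷ X ≲ B ∷ Y
  ∷-mono-≲ A⊆B (f , inj) = translation , translation-injective inj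
    where open Cons A⊆B f

  X≲X++Z : ∀ X Z → X ≲ X ++ Z
  X≲X++Z []      Z = []≲Z Z
  X≲X++Z (A ∷ X) Z = ∷-mono-≲ (λ x a → a) (X≲X++Z X Z)

  Y≲|Y|G : ∀ Y → Y ≲ replicate (length Y) G
  Y≲|Y|G []      = []≲Z []
  Y≲|Y|G (A ∷ Y) = ∷-mono-≲ (λ x a → tt) (Y≲|Y|G Y)

  module Composition {X Y Z : Cycle D}
                     (f : PiecewiseTranslation D X Y) (g : PiecewiseTranslation D Y Z) where
    module f = PiecewiseTranslation f
    module g = PiecewiseTranslation g

    P : Fin f.npieces → Piece D X Y
    P = f.piece

    Q : Fin g.npieces → Piece D Y Z
    Q = g.piece

    Meets : Fin f.npieces → Fin g.npieces → Subset Carrier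
    Meets k l x = (Piece.tgt (P k) ≡ Piece.src (Q l))
                × set (Piece.dom (P k)) x × set (Piece.dom (Q l)) (Piece.elt (P k) ∙ x)

    Meets-definable : ∀ k l → Definable (Meets k l)
    Meets-definable k l with Piece.tgt (P k) ≟ Piece.src (Q l)
    ... | yes t≡s = def-ext (λ x → (t≡s ,_) , proj₂)
                      (def-∩ (def (Piece.dom (P k))) (preimage-definable (Piece.elt (P k)) (Piece.dom (Q l))))
    ... | no t≢s  = def-ext (λ x → (λ ()) , (λ m → t≢s (proj₁ m))) def-empty

    composite-piece : Fin f.npieces × Fin g.npieces → Piece D X Z
    composite-piece (k , l) = record
      { src  = Piece.src (P k)
      ; dom  = defset (Meets k l) (Meets-definable k l)
      ; dom⊆ = λ x m → Piece.dom⊆ (P k) x (proj₁ (proj₂ m))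
      ; elt  = Piece.elt (Q l) ∙ Piece.elt (P k)
      ; tgt  = Piece.tgt (Q l)
      ; into = λ x m → subst (comp D Z (Piece.tgt (Q l))) (sym (assoc _ _ _))
                             (Piece.into (Q l) _ (proj₂ (proj₂ m))) }

    composite-cover : ∀ i x → comp D X i x →
      Σ (Fin f.npieces × Fin g.npieces) λ kl →
        (Piece.src (composite-piece kl) ≡ i) × set (Piece.dom (composite-piece kl)) x
    composite-cover i x x∈i with f.cover i x x∈i
    ... | k , src≡i , x∈k with g.cover (Piece.tgt (P k)) _ (Piece.into (P k) x x∈k)
    ... | l , src≡tgt , fx∈l = (k , l) , src≡i , sym src≡tgt , x∈k , fx∈l

    composite-disjoint : ∀ kl kl' x → Piece.src (composite-piece kl) ≡ Piece.src (composite-piece kl') →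
      set (Piece.dom (composite-piece kl)) x → set (Piece.dom (composite-piece kl')) x → kl ≡ kl'
    composite-disjoint (k , l) (k' , l') x e (t , d , q) (t' , d' , q')
      with f.disjoint k k' x e d d'
    ... | refl with g.disjoint l l' _ (trans (sym t) t') q q'
    ... | refl = refl

    composite-injective : Injective D f → Injective D g →
      ∀ kl kl' x x' → set (Piece.dom (composite-piece kl)) x → set (Piece.dom (composite-piece kl')) x' →
      Piece.tgt (composite-piece kl) ≡ Piece.tgt (composite-piece kl') →
      Piece.elt (composite-piece kl) ∙ x ≡ Piece.elt (composite-piece kl') ∙ x' →
      Piece.src (composite-piece kl) ≡ Piece.src (composite-piece kl') × x ≡ x'
    composite-injective inj-f inj-g (k , l) (k' , l') x x' (t , d , q) (t' , d' , q') et e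
      with inj-g l l' _ _ q q' et (trans (sym (assoc _ _ _)) (trans e (assoc _ _ _)))
    ... | s , fx≡fx' = inj-f k k' x x' d d' (trans t (trans s (sym t'))) fx≡fx'

    -- Pairs of pieces are enumerated through Fin (m * n) ≅ Fin m × Fin n.
    index : Fin (f.npieces * g.npieces) → Fin f.npieces × Fin g.npieces
    index = remQuot g.npieces

    index-injective : ∀ c c' → index c ≡ index c' → c ≡ c'
    index-injective c c' e = begin
      c                        ≡⟨ sym (combine-remQuot {f.npieces} g.npieces c) ⟩
      uncurry combine (index c)  ≡⟨ cong (uncurry combine) e ⟩
      uncurry combine (index c') ≡⟨ combine-remQuot {f.npieces} g.npieces c' ⟩
      c'                       ∎
      where open ≡-Reasoning

    composite : PiecewiseTranslation D X Z
    composite = record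
      { npieces  = f.npieces * g.npieces
      ; piece    = λ c → composite-piece (index c)
      ; cover    = cover
      ; disjoint = λ c c' x e d d' → index-injective c c' (composite-disjoint (index c) (index c') x e d d') }
      where
      cover : ∀ i x → comp D X i x →
        Σ (Fin (f.npieces * g.npieces)) λ c →
          (Piece.src (composite-piece (index c)) ≡ i) × set (Piece.dom (composite-piece (index c))) x
      cover i x x∈i with composite-cover i x x∈i
      ... | (k , l) , p = combine k l ,
            subst (λ kl → (Piece.src (composite-piece kl) ≡ i) × set (Piece.dom (composite-piece kl)) x)
                  (sym (remQuot-combine k l)) p

  ≲-trans : ∀ {X Y Z} → X ≲ Y → Y ≲ Z → X ≲ Z
  ≲-trans (f , inj-f) (g , inj-g) =
    composite , λ c c' → composite-injective inj-f inj-g (index c) (index c')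
    where open Composition f g

  iterate-paradoxical : ∀ {Y} → G ∷ Y ≲ Y → ∀ k → replicate (suc k) G ++ Y ≲ Y
  iterate-paradoxical p zero    = p
  iterate-paradoxical p (suc k) = ≲-trans (∷-mono-≲ (λ x a → a) (iterate-paradoxical p k)) p

  G∷X⋦[] : ∀ {X} → ¬ (G ∷ X ≲ [])
  G∷X⋦[] (f , _) with PiecewiseTranslation.cover f fzero ε tt
  ... | k , _ , _ with Piece.tgt (PiecewiseTranslation.piece f k)
  ... | ()

  paradoxical⇒sucnG≲nG : ∀ {Y} → G ∷ Y ≲ Y → Σ ℕ λ n → (1 ≤ n) × replicate (suc n) G ≲ replicate n G
  paradoxical⇒sucnG≲nG {[]}    p = ⊥-elim (G∷X⋦[] p)
  paradoxical⇒sucnG≲nG {A ∷ Y} p = length (A ∷ Y) , s≤s z≤n ,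
    ≲-trans (X≲X++Z (replicate (suc (length (A ∷ Y))) G) (A ∷ Y))
      (≲-trans (iterate-paradoxical p (length (A ∷ Y))) (Y≲|Y|G (A ∷ Y)))

corollary4p6 : (D : DefinableGroup) →
    HasDefParadoxicalDecomposition D ⇔
      Σ ℕ (λ n → (1 ≤ n) × _≼_ D (_·G D (suc n)) (_·G D n))
corollary4p6 D = mk⇔ (λ (_ , p) → paradoxical⇒sucnG≲nG D p)
                     (λ (n , _ , p) → _·G D n , p)
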